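{- Let $m\geqslant 2$ and $1\leqslant\ell<m$. The number of edges in the abelian Rauzy graph $G_{m,\ell}$ of order $\ell$ of $\mathbf{t}_m$ is $m(1+\ell m-\ell)$.
   Context: $\mathcal{A}_m=\{0,\ldots,m-1\}=\mathbb{Z}/m\mathbb{Z}$; $\sigma_m$ is the morphism $\sigma_m(i)=i\,(i+1)\cdots(i+m-1)$ (letters mod $m$), and $\mathbf{t}_m=\lim_{j\to\infty}\sigma_m^j(0)$. $\Psi(w)$ denotes the Parikh vector of $w$ (number of occurrences of each letter). The abelian Rauzy graph $G_{m,\ell}$ has as vertices the Parikh vectors $\Psi(w)$ of factors $w$ of length $\ell$ of $\mathbf{t}_m$; for letters $a,b$ and a word $U$ such that $aUb$ is a factor of $\mathbf{t}_m$ of length $\ell+1$, there is a directed edge from $\Psi(aU)$ to $\Psi(Ub)$ labeled $(a,b)$ (an edge is determined by its source, target and label). -}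

module Defs where

open import Data.Nat using (ℕ; zero; suc; _+_; NonZero)
open import Data.Nat.DivMod using (_mod_)
open import Data.Fin using (Fin; toℕ)
open import Data.Fin.Properties using (_≟_)
open import Data.List using (List; []; _∷_; map; upTo; concatMap; filter; length)
open import Data.Vec using (Vec; tabulate)
open import Data.Product using (Σ; _×_; _,_)
open import Relation.Binary.PropositionalEquality using (_≡_)

-- Letters of the alphabet A_m = Z/mZ are elements of Fin m.

σ : (m : ℕ) .{{_ : NonZero m}} → Fin m → List (Fin m)
σ m i = map (λ k → (toℕ i + k) mod m) (upTo m)

σ* : (m : ℕ) .{{_ : NonZero m}} → List (Fin m) → List (Fin m)
σ* m w = concatMap (σ m) w

σ^ : (m : ℕ) .{{_ : NonZero m}} → ℕ → List (Fin m)
σ^ m zero    = (0 mod m) ∷ []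
σ^ m (suc j) = σ* m (σ^ m j)

nth : {A : Set} → A → List A → ℕ → A
nth d []       n       = d
nth d (x ∷ xs) zero    = x
nth d (x ∷ xs) (suc n) = nth d xs n

-- t_m = lim_j σ_m^j(0).  The n-th letter of t_m is the n-th letter of
-- σ_m^(n+1)(0), which has length m^(n+1) > n (for m ≥ 2) and is a prefix of
-- all further iterates.
t : (m : ℕ) .{{_ : NonZero m}} → ℕ → Fin m
t m n = nth (0 mod m) (σ^ m (suc n)) n

factorAt : (m : ℕ) .{{_ : NonZero m}} → ℕ → ℕ → List (Fin m)
factorAt m i k = map (λ j → t m (i + j)) (upTo k)

Ψ : (m : ℕ) → List (Fin m) → Vec ℕ m
Ψ m w = tabulate (λ c → length (filter (c ≟_) w))

-- Edges of the abelian Rauzy graph G_{m,ℓ}: (source, target, label (a , b)).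
Edge : ℕ → Set
Edge m = Vec ℕ m × Vec ℕ m × (Fin m × Fin m)

-- e = (Ψ(aU), Ψ(Ub), (a,b)) is an edge iff aUb is a factor of t_m of length ℓ+1,
-- i.e. aUb = factorAt m i (ℓ + 1) for some position i.
IsEdge : (m : ℕ) .{{_ : NonZero m}} → ℕ → Edge m → Set
IsEdge m ℓ (p , q , (a , b)) =
  Σ ℕ (λ i → (t m i ≡ a) × (t m (i + ℓ) ≡ b)
           × (Ψ m (factorAt m i ℓ) ≡ p) × (Ψ m (factorAt m (suc i) ℓ) ≡ q))

{-# OPTIONS --safe #-}
module Submission where

-- In base m, t_m(n) is the digit sum of n modulo m; in particular t_m(qm + r) = t_m(q) + r for r < m.
-- As ℓ < m, a factor of length ℓ + 1 crosses at most one multiple of m, so it is a window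
-- k ↦ x + k + (s if j ≤ k, else 0) (mod m) with 1 ≤ j; conversely every window with 1 ≤ j ≤ m occurs,
-- because every two-letter word occurs in t_m.  The edge of a window determines x (its first letter),
-- s (its last letter, once j ≤ ℓ) and, if s ≠ 0, the jump position j: moving the jump from j to j'
-- replaces the arc x + s + [j, j') of ℤ/m by the different arc x + [j, j'), which changes the Parikh
-- vector of the first ℓ letters.  The jump-free windows all coincide, so the edges correspond to x
-- together with either j = ℓ and any s, or j < ℓ and s ≠ 0: that is m(m + (ℓ − 1)(m − 1)) = m(1 + ℓm − ℓ).

open import Defs
open import Data.Nat hiding (_≟_)
open import Data.Nat.Properties hiding (_≟_)
open import Data.Nat.DivMod
open import Data.Nat.Tactic.RingSolver using (solve-∀)
open import Data.Fin using (Fin; zero; suc; toℕ; fromℕ<)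
open import Data.Fin.Properties using (_≟_; toℕ<n; toℕ-fromℕ<; toℕ-injective; fromℕ<-cong; fromℕ<-injective; fromℕ<-toℕ; *↔×; +↔⊎)
open import Data.List using (List; []; _∷_; _++_; length; upTo; applyUpTo; concatMap; filter; tabulate)
open import Data.List.Properties using (length-++; length-map; length-upTo; map-upTo; length-tabulate)
open import Data.List.Membership.Propositional using (_∈_)
open import Data.List.Membership.Propositional.Properties using (∈-tabulate⁺)
open import Data.List.Relation.Unary.All using (All)
import Data.List.Relation.Unary.All.Properties as All
open import Data.List.Relation.Unary.Unique.Propositional using (Unique)
import Data.List.Relation.Unary.Unique.Propositional.Properties as Unique
open import Data.Vec using (lookup)
open import Data.Vec.Properties using (lookup∘tabulate)
open import Data.Product using (Σ; ∃-syntax; _×_; _,_; proj₁; proj₂; map₂)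
open import Data.Product.Function.NonDependent.Propositional using (_×-↔_)
open import Data.Sum using (_⊎_; inj₁; inj₂)
open import Data.Sum.Function.Propositional using (_⊎-↔_)
open import Function using (_∘_; _↔_; Inverse)
open import Function.Definitions using (Injective)
open import Function.Properties.Inverse using (↔-refl; ↔-trans)
open import Relation.Binary.Definitions using (tri<; tri≈; tri>)
open import Relation.Binary.PropositionalEquality
open import Relation.Nullary using (¬_; yes; no; contradiction)
open import Relation.Unary using (Decidable)

module _ {A : Set} (d : A) where

  nth-++ˡ : ∀ xs ys {i} → i < length xs → nth d (xs ++ ys) i ≡ nth d xs i
  nth-++ˡ (x ∷ xs) ys {zero}  _   = refl
  nth-++ˡ (x ∷ xs) ys {suc i} i<n = nth-++ˡ xs ys (s<s⁻¹ i<n)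

  nth-++ʳ : ∀ xs ys i → nth d (xs ++ ys) (length xs + i) ≡ nth d ys i
  nth-++ʳ []       ys i = refl
  nth-++ʳ (x ∷ xs) ys i = nth-++ʳ xs ys i

  nth-applyUpTo : ∀ f {n i} → i < n → nth d (applyUpTo f n) i ≡ f i
  nth-applyUpTo f {suc n} {zero}  _   = refl
  nth-applyUpTo f {suc n} {suc i} i<n = nth-applyUpTo (f ∘ suc) (s<s⁻¹ i<n)

applyUpTo-cong : ∀ {A : Set} {f g : ℕ → A} n → (∀ k → k < n → f k ≡ g k) →
                 applyUpTo f n ≡ applyUpTo g n
applyUpTo-cong zero    _   = refl
applyUpTo-cong (suc n) f≗g = cong₂ _∷_ (f≗g 0 z<s) (applyUpTo-cong n (λ k k<n → f≗g (suc k) (s<s k<n)))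

module _ {A B : Set} (f : A → List B) {k : ℕ} (|f|≡k : ∀ x → length (f x) ≡ k) where

  length-concatMap : ∀ xs → length (concatMap f xs) ≡ length xs * k
  length-concatMap []       = refl
  length-concatMap (x ∷ xs) = trans (length-++ (f x)) (cong₂ _+_ (|f|≡k x) (length-concatMap xs))

  nth-concatMap : ∀ (d : B) (e : A) xs {q r} → q < length xs → r < k →
                  nth d (concatMap f xs) (q * k + r) ≡ nth d (f (nth e xs q)) r
  nth-concatMap d e (x ∷ xs) {zero}  {r} _   r<k =
    nth-++ˡ d (f x) _ (subst (r <_) (sym (|f|≡k x)) r<k)
  nth-concatMap d e (x ∷ xs) {suc q} {r} q<n r<k = begin
    nth d (f x ++ concatMap f xs) (k + q * k + r)
      ≡⟨ cong (nth d (f x ++ concatMap f xs)) (trans (+-assoc k _ r) (cong (_+ (q * k + r)) (sym (|f|≡k x)))) ⟩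
    nth d (f x ++ concatMap f xs) (length (f x) + (q * k + r))
      ≡⟨ nth-++ʳ d (f x) _ _ ⟩
    nth d (concatMap f xs) (q * k + r)
      ≡⟨ nth-concatMap d e xs (s<s⁻¹ q<n) r<k ⟩
    nth d (f (nth e xs q)) r
      ∎
    where open ≡-Reasoning

module _ {A : Set} {P : A → Set} (P? : Decidable P) where

  count : List A → ℕ
  count xs = length (filter P? xs)

  count-applyUpTo-≤ : ∀ f g n → (∀ k → k < n → P (f k) → P (g k)) →
                      count (applyUpTo f n) ≤ count (applyUpTo g n)
  count-applyUpTo-≤ f g zero    _   = z≤n
  count-applyUpTo-≤ f g (suc n) f⇒g
    with P? (f 0) | P? (g 0) | count-applyUpTo-≤ (f ∘ suc) (g ∘ suc) n (λ k k<n → f⇒g (suc k) (s<s k<n))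
  ... | yes _   | yes _   | ih = s≤s ih
  ... | yes Pf0 | no ¬Pg0 | _  = contradiction (f⇒g 0 z<s Pf0) ¬Pg0
  ... | no _    | yes _   | ih = m≤n⇒m≤1+n ih
  ... | no _    | no _    | ih = ih

  count-applyUpTo-< : ∀ f g n → (∀ k → k < n → P (f k) → P (g k)) →
                      ∀ {k₀} → k₀ < n → ¬ P (f k₀) → P (g k₀) →
                      count (applyUpTo f n) < count (applyUpTo g n)
  count-applyUpTo-< f g (suc n) f⇒g {zero} _ ¬Pf0 Pg0 with P? (f 0) | P? (g 0)
  ... | yes Pf0 | _       = contradiction Pf0 ¬Pf0
  ... | no _    | no ¬Pg0 = contradiction Pg0 ¬Pg0
  ... | no _    | yes _   = s≤s (count-applyUpTo-≤ (f ∘ suc) (g ∘ suc) n (λ k k<n → f⇒g (suc k) (s<s k<n)))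
  count-applyUpTo-< f g (suc n) f⇒g {suc k₀} k₀<n ¬Pf Pg
    with P? (f 0) | P? (g 0)
       | count-applyUpTo-< (f ∘ suc) (g ∘ suc) n (λ k k<n → f⇒g (suc k) (s<s k<n)) (s<s⁻¹ k₀<n) ¬Pf Pg
  ... | yes _   | yes _   | ih = s<s ih
  ... | yes Pf0 | no ¬Pg0 | _  = contradiction (f⇒g 0 z<s Pf0) ¬Pg0
  ... | no _    | yes _   | ih = m<n⇒m<1+n ih
  ... | no _    | no _    | ih = ih

Ψ-count : ∀ {m} (w w' : List (Fin m)) → Ψ m w ≡ Ψ m w' → ∀ c → count (c ≟_) w ≡ count (c ≟_) w'
Ψ-count {m} w w' eq c = begin
  count (c ≟_) w   ≡⟨ lookup∘tabulate (λ c → count (c ≟_) w) c ⟨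
  lookup (Ψ m w) c  ≡⟨ cong (λ v → lookup v c) eq ⟩
  lookup (Ψ m w') c ≡⟨ lookup∘tabulate (λ c → count (c ≟_) w') c ⟩
  count (c ≟_) w'  ∎
  where open ≡-Reasoning

Ψ-≢ : ∀ {m n} (u v : ℕ → Fin m) (c : Fin m) → (∀ k → k < n → c ≡ u k → c ≡ v k) →
      ∀ {k₀} → k₀ < n → c ≢ u k₀ → c ≡ v k₀ → Ψ m (applyUpTo u n) ≢ Ψ m (applyUpTo v n)
Ψ-≢ {n = n} u v c u⇒v k₀<n c≢u c≡v eq =
  <⇒≢ (count-applyUpTo-< (c ≟_) u v n u⇒v k₀<n c≢u c≡v) (Ψ-count (applyUpTo u n) (applyUpTo v n) eq c)

confined-to-block : ∀ {A : Set} {j j'} {u v : ℕ → A} {c} → (∀ k → k < j ⊎ j' ≤ k → u k ≡ v k) →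
                    (∀ d → j + d < j' → c ≢ u (j + d)) → ∀ k → c ≡ u k → c ≡ v k
confined-to-block {j = j} {j'} agree avoid k c≡uk with k <? j | k <? j'
... | yes k<j | _        = trans c≡uk (agree k (inj₁ k<j))
... | no _    | no k≮j'  = trans c≡uk (agree k (inj₂ (≮⇒≥ k≮j')))
... | no k≮j  | yes k<j' with d , refl ← m≤n⇒∃[o]m+o≡n (≮⇒≥ k≮j) = contradiction c≡uk (avoid d k<j')

enumerate-image : ∀ {A B : Set} {n} (P : B → Set) → Fin n ↔ A → (f : A → B) → Injective _≡_ _≡_ f →
                  (∀ a → P (f a)) → (∀ b → P b → ∃[ a ] b ≡ f a) →
                  Σ (List B) λ E → Unique E × All P E × (∀ b → P b → b ∈ E) × length E ≡ n
enumerate-image P enum f f-injective P-image image-P =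
  tabulate (f ∘ to) ,
  Unique.tabulate⁺ (λ {i} {j} eq →
    trans (sym (strictlyInverseʳ i)) (trans (cong from (f-injective eq)) (strictlyInverseʳ j))) ,
  All.tabulate⁺ (P-image ∘ to) ,
  (λ b Pb → let a , b≡fa = image-P b Pb in
    subst (_∈ tabulate (f ∘ to)) (trans (cong f (strictlyInverseˡ a)) (sym b≡fa)) (∈-tabulate⁺ (from a))) ,
  length-tabulate (f ∘ to)
  where open Inverse enum

module _ {m : ℕ} .{{_ : NonZero m}} where

  i≡[i/m]*m+i%m : ∀ i → i ≡ i / m * m + i % m
  i≡[i/m]*m+i%m i = trans (m≡m%n+[m/n]*n i m) (+-comm (i % m) _)

  %-cong-+ : ∀ {a a' b b'} → a % m ≡ a' % m → b % m ≡ b' % m → (a + b) % m ≡ (a' + b') % m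
  %-cong-+ {a} {a'} {b} {b'} a≡a' b≡b' = begin
    (a + b) % m            ≡⟨ %-distribˡ-+ a b m ⟩
    (a % m + b % m) % m    ≡⟨ cong₂ (λ u v → (u + v) % m) a≡a' b≡b' ⟩
    (a' % m + b' % m) % m  ≡⟨ %-distribˡ-+ a' b' m ⟨
    (a' + b') % m          ∎
    where open ≡-Reasoning

  [m%n+o]%n≡[m+o]%n : ∀ a b → (a % m + b) % m ≡ (a + b) % m
  [m%n+o]%n≡[m+o]%n a b = %-cong-+ (m%n%n≡m%n a m) refl

  +-cancelˡ-% : ∀ a {u v} → (a + u) % m ≡ (a + v) % m → u % m ≡ v % m
  +-cancelˡ-% a {u} {v} eq = begin
    u % m              ≡⟨ add-complement u ⟨
    (ā + (a + u)) % m  ≡⟨ %-cong-+ {ā} refl eq ⟩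
    (ā + (a + v)) % m  ≡⟨ add-complement v ⟩
    v % m              ∎
    where
    open ≡-Reasoning
    ā = m ∸ a % m
    rearrange : ∀ ā r Q w → ā + (r + Q + w) ≡ w + (r + ā) + Q
    rearrange = solve-∀
    add-complement : ∀ w → (ā + (a + w)) % m ≡ w % m
    add-complement w = begin
      (ā + (a + w)) % m                  ≡⟨ cong (λ z → (ā + (z + w)) % m) (m≡m%n+[m/n]*n a m) ⟩
      (ā + (a % m + a / m * m + w)) % m  ≡⟨ cong (_% m) (rearrange ā (a % m) (a / m * m) w) ⟩
      (w + (a % m + ā) + a / m * m) % m  ≡⟨ cong (λ z → (w + z + a / m * m) % m) (m+[n∸m]≡n (m%n≤n a m)) ⟩
      (w + m + a / m * m) % m            ≡⟨ [m+kn]%n≡m%n (w + m) (a / m) m ⟩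
      (w + m) % m                        ≡⟨ [m+n]%n≡m%n w m ⟩
      w % m                              ∎

  mod-cong : ∀ {a b} → a % m ≡ b % m → a mod m ≡ b mod m
  mod-cong {a} {b} eq = fromℕ<-cong (a % m) (b % m) eq (m%n<n a m) (m%n<n b m)

  toℕ-mod : ∀ a → toℕ (a mod m) ≡ a % m
  toℕ-mod a = toℕ-fromℕ< (m%n<n a m)

  %-toℕ-mod : ∀ a → toℕ (a mod m) % m ≡ a % m
  %-toℕ-mod a = trans (cong (_% m) (toℕ-mod a)) (m%n%n≡m%n a m)

  mod-toℕ : ∀ (i : Fin m) → toℕ i mod m ≡ i
  mod-toℕ i = trans (fromℕ<-cong _ _ (m<n⇒m%n≡m (toℕ<n i)) _ (toℕ<n i)) (fromℕ<-toℕ i (toℕ<n i))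

  +-mod-injective : ∀ a {u v} → u < m → v < m → (a + u) mod m ≡ (a + v) mod m → u ≡ v
  +-mod-injective a {u} {v} u<m v<m eq = begin
    u      ≡⟨ m<n⇒m%n≡m u<m ⟨
    u % m  ≡⟨ +-cancelˡ-% a (fromℕ<-injective _ _ (m%n<n (a + u) m) (m%n<n (a + v) m) eq) ⟩
    v % m  ≡⟨ m<n⇒m%n≡m v<m ⟩
    v      ∎
    where open ≡-Reasoning

jump : ℕ → ℕ → ℕ → ℕ
jump zero    s _       = s
jump (suc j) s zero    = 0
jump (suc j) s (suc k) = jump j s k

jump-< : ∀ {j k} s → k < j → jump j s k ≡ 0
jump-< {suc j} {zero}  s _   = refl
jump-< {suc j} {suc k} s k<j = jump-< s (s<s⁻¹ k<j)

jump-≥ : ∀ {j k} s → j ≤ k → jump j s k ≡ s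
jump-≥ {zero}          s _   = refl
jump-≥ {suc j} {suc k} s j≤k = jump-≥ s (s≤s⁻¹ j≤k)

jump-0 : ∀ j k → jump j 0 k ≡ 0
jump-0 zero    k       = refl
jump-0 (suc j) zero    = refl
jump-0 (suc j) (suc k) = jump-0 j k

module Windows (m : ℕ) .{{_ : NonZero m}} where

  window : ℕ → ℕ → ℕ → ℕ → Fin m
  window x j s k = (x + k + jump j s k) mod m

  window-< : ∀ x s {j k} → k < j → window x j s k ≡ (x + k + 0) mod m
  window-< x s {j} {k} k<j = cong (λ z → (x + k + z) mod m) (jump-< s k<j)

  window-≥ : ∀ x s {j k} → j ≤ k → window x j s k ≡ (x + k + s) mod m
  window-≥ x s {j} {k} j≤k = cong (λ z → (x + k + z) mod m) (jump-≥ s j≤k)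

  window-0 : ∀ x j k → window x j 0 k ≡ (x + k + 0) mod m
  window-0 x j k = cong (λ z → (x + k + z) mod m) (jump-0 j k)

  jump-cong-% : ∀ j k {s s'} → s % m ≡ s' % m → jump j s k % m ≡ jump j s' k % m
  jump-cong-% zero    k       s≡s' = s≡s'
  jump-cong-% (suc j) zero    _    = refl
  jump-cong-% (suc j) (suc k) s≡s' = jump-cong-% j k s≡s'

  window-cong-% : ∀ x x' j s s' k → x % m ≡ x' % m → s % m ≡ s' % m →
                  window x j s k ≡ window x' j s' k
  window-cong-% _ _ j _ _ k x≡x' s≡s' = mod-cong (%-cong-+ (%-cong-+ x≡x' refl) (jump-cong-% j k s≡s'))

  window-agree-outside : ∀ x s {j j' k} → j ≤ j' → k < j ⊎ j' ≤ k → window x j s k ≡ window x j' s k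
  window-agree-outside x s j≤j' (inj₁ k<j)  = trans (window-< x s k<j) (sym (window-< x s (<-≤-trans k<j j≤j')))
  window-agree-outside x s j≤j' (inj₂ j'≤k) = trans (window-≥ x s (≤-trans j≤j' j'≤k)) (sym (window-≥ x s j'≤k))

  -- On [j, j') only the first word is shifted; the letter x + j + s − 1 occurs in the second word
  -- at j + s − 1, but nowhere in the first word on [j, j').
  window-Ψ-≢-shift≤block : ∀ {n x j j' s} → j + s ≤ j' → j' ≤ n → n < m → 0 < s → s < m →
                           Ψ m (applyUpTo (window x j s) n) ≢ Ψ m (applyUpTo (window x j' s) n)
  window-Ψ-≢-shift≤block {n} {x} {j} {j'} {suc s'} j+s≤j' j'≤n n<m _ s<m =
    Ψ-≢ (window x j s) (window x j' s) c
        (λ k _ → confined-to-block (λ _ → window-agree-outside x s (≤-trans (m≤m+n j s) j+s≤j')) avoid k)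
        (<-≤-trans k₀<j' j'≤n) c≢uk₀ refl
    where
    s = suc s'
    k₀ = j + s'
    k₀<j' : k₀ < j'
    k₀<j' = <-≤-trans (+-monoʳ-< j (n<1+n s')) j+s≤j'
    c = window x j' s k₀
    c≡ : c ≡ (x + k₀ + 0) mod m
    c≡ = window-< x s k₀<j'
    c≢uk₀ : c ≢ window x j s k₀
    c≢uk₀ eq = 0≢1+n (+-mod-injective (x + k₀) (≤-<-trans z≤n s<m) s<m
                 (trans (sym c≡) (trans eq (window-≥ x s (m≤m+n j s')))))
    rearrange : ∀ x j d s' → x + (j + d) + suc s' ≡ x + (j + s') + suc d
    rearrange = solve-∀
    avoid : ∀ d → j + d < j' → c ≢ window x j s (j + d)
    avoid d j+d<j' eq = 0≢1+n (+-mod-injective (x + k₀) (≤-<-trans z≤n s<m) 1+d<m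
      (trans (sym c≡) (trans eq (trans (window-≥ x s (m≤m+n j d)) (cong (λ z → z mod m) (rearrange x j d s'))))))
      where
      1+d<m : suc d < m
      1+d<m = ≤-<-trans (≤-trans (s≤s (m≤n+m d j)) j+d<j') (≤-<-trans j'≤n n<m)

  -- The letter x + j + s occurs in the first word at j, but nowhere in the second word on [j, j').
  window-Ψ-≢-block<shift : ∀ {n x j j' s} → j < j' → j' < j + s → j' ≤ n → 0 < s → s < m →
                           Ψ m (applyUpTo (window x j s) n) ≢ Ψ m (applyUpTo (window x j' s) n)
  window-Ψ-≢-block<shift {n} {x} {j} {j'} {s} j<j' j'<j+s j'≤n 0<s s<m eq =
    Ψ-≢ (window x j' s) (window x j s) c
        (λ k _ → confined-to-block (λ k out → sym (window-agree-outside x s (<⇒≤ j<j') out)) avoid k)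
        (<-≤-trans j<j' j'≤n) c≢uj refl (sym eq)
    where
    c = window x j s j
    c≡ : c ≡ (x + j + s) mod m
    c≡ = window-≥ x s ≤-refl
    c≢uj : c ≢ window x j' s j
    c≢uj eq = <⇒≢ 0<s (+-mod-injective (x + j) (≤-<-trans z≤n s<m) s<m
                (trans (sym (window-< x s j<j')) (trans (sym eq) c≡)))
    avoid : ∀ d → j + d < j' → c ≢ window x j' s (j + d)
    avoid d j+d<j' eq = <⇒≢ d<s (+-mod-injective (x + j) (<-trans d<s s<m) s<m
      (trans (cong (λ z → z mod m) (trans (+-assoc x j d) (sym (+-identityʳ _))))
             (trans (sym (window-< x s j+d<j')) (trans (sym eq) c≡))))
      where
      d<s : d < s
      d<s = +-cancelˡ-< j d s (<-trans j+d<j' j'<j+s)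

  window-Ψ-< : ∀ {n x j j' s} → j < j' → j' ≤ n → n < m → 0 < s → s < m →
               Ψ m (applyUpTo (window x j s) n) ≢ Ψ m (applyUpTo (window x j' s) n)
  window-Ψ-< {j = j} {j'} {s} j<j' j'≤n n<m 0<s s<m with j + s ≤? j'
  ... | yes j+s≤j' = window-Ψ-≢-shift≤block j+s≤j' j'≤n n<m 0<s s<m
  ... | no j+s≰j'  = window-Ψ-≢-block<shift j<j' (≰⇒> j+s≰j') j'≤n 0<s s<m

  window-Ψ-injective : ∀ {n} x s {j j'} → j ≤ n → j' ≤ n → n < m → 0 < s → s < m →
                       Ψ m (applyUpTo (window x j s) n) ≡ Ψ m (applyUpTo (window x j' s) n) → j ≡ j'
  window-Ψ-injective x s {j} {j'} j≤n j'≤n n<m 0<s s<m eq with <-cmp j j'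
  ... | tri< j<j' _ _ = contradiction eq (window-Ψ-< j<j' j'≤n n<m 0<s s<m)
  ... | tri≈ _ j≡j' _ = j≡j'
  ... | tri> _ _ j'<j = contradiction (sym eq) (window-Ψ-< j'<j j≤n n<m 0<s s<m)

n<m^n : ∀ {m} .{{_ : NonZero m}} → 1 < m → ∀ n → n < m ^ n
n<m^n         1<m zero    = z<s
n<m^n {m} 1<m (suc n) = begin-strict
  suc n          ≤⟨ n<m^n 1<m n ⟩
  m ^ n          ≡⟨ *-identityˡ (m ^ n) ⟨
  1 * m ^ n      <⟨ *-monoˡ-< (m ^ n) {{m^n≢0 m n}} 1<m ⟩
  m * m ^ n      ∎
  where open ≤-Reasoning

q*m+r<m^1+k : ∀ {m k q r} → q < m ^ k → r < m → q * m + r < m ^ suc k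
q*m+r<m^1+k {m} {k} {q} {r} q<m^k r<m = begin-strict
  q * m + r      <⟨ +-monoʳ-< (q * m) r<m ⟩
  q * m + m      ≡⟨ +-comm (q * m) m ⟩
  suc q * m      ≤⟨ *-monoˡ-≤ m q<m^k ⟩
  m ^ k * m      ≡⟨ *-comm (m ^ k) m ⟩
  m ^ suc k      ∎
  where open ≤-Reasoning

module Letters (m : ℕ) .{{_ : NonZero m}} where

  open Windows m

  private
    0ₘ : Fin m
    0ₘ = 0 mod m

  length-σ : ∀ i → length (σ m i) ≡ m
  length-σ i = trans (length-map _ (upTo m)) (length-upTo m)

  nth-σ : ∀ i {r} → r < m → nth 0ₘ (σ m i) r ≡ (toℕ i + r) mod m
  nth-σ i {r} r<m = trans (cong (λ w → nth 0ₘ w r) (map-upTo _ m)) (nth-applyUpTo 0ₘ _ r<m)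

  length-σ^ : ∀ k → length (σ^ m k) ≡ m ^ k
  length-σ^ zero    = refl
  length-σ^ (suc k) = begin
    length (σ^ m (suc k))  ≡⟨ length-concatMap (σ m) length-σ (σ^ m k) ⟩
    length (σ^ m k) * m    ≡⟨ cong (_* m) (length-σ^ k) ⟩
    m ^ k * m              ≡⟨ *-comm (m ^ k) m ⟩
    m ^ suc k              ∎
    where open ≡-Reasoning

  nth-σ^-suc : ∀ k {q r} → q < m ^ k → r < m →
               nth 0ₘ (σ^ m (suc k)) (q * m + r) ≡ (toℕ (nth 0ₘ (σ^ m k) q) + r) mod m
  nth-σ^-suc k {q} q<m^k r<m =
    trans (nth-concatMap (σ m) length-σ 0ₘ 0ₘ (σ^ m k) (subst (q <_) (sym (length-σ^ k)) q<m^k) r<m)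
          (nth-σ (nth 0ₘ (σ^ m k) q) r<m)

  σ^-stable : ∀ k {i} → i < m ^ k → nth 0ₘ (σ^ m (suc k)) i ≡ nth 0ₘ (σ^ m k) i
  σ^-stable zero {zero} _ =
    trans (nth-σ^-suc 0 z<s (>-nonZero⁻¹ m))
          (mod-cong (trans (cong (λ z → (z + 0) % m) (toℕ-mod 0)) ([m%n+o]%n≡[m+o]%n 0 0)))
  σ^-stable zero {suc i} (s<s ())
  σ^-stable (suc k) {i} i<m^1+k = begin
    nth 0ₘ (σ^ m (2 + k)) i                    ≡⟨ cong (nth 0ₘ (σ^ m (2 + k))) (i≡[i/m]*m+i%m i) ⟩
    nth 0ₘ (σ^ m (2 + k)) (q * m + r)
      ≡⟨ nth-σ^-suc (suc k) (<-≤-trans q<m^k (^-monoʳ-≤ m (n≤1+n k))) r<m ⟩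
    (toℕ (nth 0ₘ (σ^ m (suc k)) q) + r) mod m  ≡⟨ cong (λ a → (toℕ a + r) mod m) (σ^-stable k q<m^k) ⟩
    (toℕ (nth 0ₘ (σ^ m k) q) + r) mod m        ≡⟨ nth-σ^-suc k q<m^k r<m ⟨
    nth 0ₘ (σ^ m (suc k)) (q * m + r)          ≡⟨ cong (nth 0ₘ (σ^ m (suc k))) (i≡[i/m]*m+i%m i) ⟨
    nth 0ₘ (σ^ m (suc k)) i                    ∎
    where
    open ≡-Reasoning
    q = i / m
    r = i % m
    r<m = m%n<n i m
    q<m^k : q < m ^ k
    q<m^k = m<n*o⇒m/o<n (subst (i <_) (*-comm m (m ^ k)) i<m^1+k)

  σ^-stable-+ : ∀ k o {i} → i < m ^ k → nth 0ₘ (σ^ m (o + k)) i ≡ nth 0ₘ (σ^ m k) i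
  σ^-stable-+ k zero    _      = refl
  σ^-stable-+ k (suc o) i<m^k =
    trans (σ^-stable (o + k) (<-≤-trans i<m^k (^-monoʳ-≤ m (m≤n+m k o)))) (σ^-stable-+ k o i<m^k)

  τ : ℕ → ℕ
  τ i = toℕ (t m i)

  module _ (1<m : 1 < m) where

    t-nth : ∀ k {i} → i < m ^ k → t m i ≡ nth 0ₘ (σ^ m k) i
    t-nth k {i} i<m^k = begin
      nth 0ₘ (σ^ m (suc i)) i           ≡⟨ σ^-stable-+ (suc i) k i<m^1+i ⟨
      nth 0ₘ (σ^ m (k + suc i)) i       ≡⟨ cong (λ K → nth 0ₘ (σ^ m K) i) (+-comm k (suc i)) ⟩
      nth 0ₘ (σ^ m (suc i + k)) i       ≡⟨ σ^-stable-+ k (suc i) i<m^k ⟩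
      nth 0ₘ (σ^ m k) i                 ∎
      where
      open ≡-Reasoning
      i<m^1+i = <-≤-trans (n<m^n 1<m i) (^-monoʳ-≤ m (n≤1+n i))

    t-digit : ∀ q {r} → r < m → t m (q * m + r) ≡ (τ q + r) mod m
    t-digit q {r} r<m = begin
      t m (q * m + r)                            ≡⟨ t-nth (2 + q) (q*m+r<m^1+k {k = suc q} q<m^1+q r<m) ⟩
      nth 0ₘ (σ^ m (2 + q)) (q * m + r)          ≡⟨ nth-σ^-suc (suc q) {q} q<m^1+q r<m ⟩
      (toℕ (nth 0ₘ (σ^ m (suc q)) q) + r) mod m  ≡⟨ cong (λ a → (toℕ a + r) mod m) (t-nth (suc q) q<m^1+q) ⟨
      (τ q + r) mod m                            ∎
      where
      open ≡-Reasoning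
      q<m^1+q : q < m ^ suc q
      q<m^1+q = <-≤-trans (n<m^n 1<m q) (^-monoʳ-≤ m (n≤1+n q))

    τ-digit : ∀ q {a r} → τ q ≡ a % m → r < m → τ (q * m + r) ≡ (a + r) % m
    τ-digit q {a} {r} τq≡a r<m = begin
      τ (q * m + r)      ≡⟨ cong toℕ (t-digit q r<m) ⟩
      toℕ ((τ q + r) mod m) ≡⟨ toℕ-mod (τ q + r) ⟩
      (τ q + r) % m      ≡⟨ cong (λ z → (z + r) % m) τq≡a ⟩
      (a % m + r) % m    ≡⟨ [m%n+o]%n≡[m+o]%n a r ⟩
      (a + r) % m        ∎
      where open ≡-Reasoning

    τ-< : ∀ {r} → r < m → τ r ≡ r
    τ-< {r} r<m = begin
      τ r            ≡⟨ τ-digit 0 {0} τ0≡0 r<m ⟩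
      r % m          ≡⟨ m<n⇒m%n≡m r<m ⟩
      r              ∎
      where
      open ≡-Reasoning
      τ0≡0 : τ 0 ≡ 0 % m
      τ0≡0 = trans (cong toℕ (t-nth 0 z<s)) (toℕ-mod 0)

    consecutive-letters-+ : ∀ c a → ∃[ q ] τ q ≡ a % m × τ (suc q) ≡ (a + suc c) % m
    consecutive-letters-+ zero a =
      a % m * m ,
      trans (cong τ (sym (+-identityʳ (a % m * m))))
            (trans (τ-digit (a % m) τa%m≡ (>-nonZero⁻¹ m)) (cong (_% m) (+-identityʳ a))) ,
      trans (cong τ (+-comm 1 (a % m * m))) (τ-digit (a % m) τa%m≡ 1<m)
      where
      τa%m≡ : τ (a % m) ≡ a % m
      τa%m≡ = τ-< (m%n<n a m)
    consecutive-letters-+ (suc c) a with q , τq≡ , τ1+q≡ ← consecutive-letters-+ c (suc a) =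
      q * m + pred m ,
      trans (τ-digit q τq≡ (m≤pred[n]⇒suc[m]≤n ≤-refl)) (begin
        (suc a + pred m) % m  ≡⟨ cong (_% m) (trans (sym (+-suc a (pred m))) (cong (a +_) (suc-pred m))) ⟩
        (a + m) % m           ≡⟨ [m+n]%n≡m%n a m ⟩
        a % m                 ∎) ,
      trans (cong τ next) (trans (τ-digit (suc q) τ1+q≡ (>-nonZero⁻¹ m))
        (cong (_% m) (trans (+-identityʳ _) (sym (+-suc a (suc c))))))
      where
      open ≡-Reasoning
      next : suc (q * m + pred m) ≡ suc q * m + 0
      next = begin
        suc (q * m + pred m)  ≡⟨ +-suc (q * m) (pred m) ⟨
        q * m + suc (pred m)  ≡⟨ cong (q * m +_) (suc-pred m) ⟩
        q * m + m             ≡⟨ +-comm (q * m) m ⟩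
        suc q * m             ≡⟨ +-identityʳ _ ⟨
        suc q * m + 0         ∎

    consecutive-letters : ∀ a b → ∃[ q ] τ q ≡ a % m × τ (suc q) ≡ b % m
    consecutive-letters a b with q , τq≡ , τ1+q≡ ← consecutive-letters-+ (b + pred m * suc a) a =
      q , τq≡ , trans τ1+q≡ (trans (cong (_% m) sum≡) ([m+kn]%n≡m%n b (suc a) m))
      where
      identity : ∀ a b p → a + suc (b + p * suc a) ≡ b + suc a * suc p
      identity = solve-∀
      sum≡ : a + suc (b + pred m * suc a) ≡ b + suc a * m
      sum≡ = trans (identity a b (pred m)) (cong (λ z → b + suc a * z) (suc-pred m))

    -- m ∸ τ q stands for −τ q modulo m.
    t-factor : ∀ q {r k} → r < m → k < m →
               t m (q * m + r + k) ≡ window (τ q + r) (m ∸ r) (τ (suc q) + (m ∸ τ q)) k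
    t-factor q {r} {k} r<m k<m with k <? m ∸ r
    ... | yes k<m∸r = begin
      t m (q * m + r + k)      ≡⟨ cong (t m) (+-assoc (q * m) r k) ⟩
      t m (q * m + (r + k))    ≡⟨ t-digit q r+k<m ⟩
      (τ q + (r + k)) mod m    ≡⟨ cong (λ z → z mod m) (trans (+-identityʳ _) (+-assoc (τ q) r k)) ⟨
      (τ q + r + k + 0) mod m  ≡⟨ window-< (τ q + r) _ k<m∸r ⟨
      window (τ q + r) (m ∸ r) (τ (suc q) + (m ∸ τ q)) k ∎
      where
      open ≡-Reasoning
      r+k<m : r + k < m
      r+k<m = <-≤-trans (+-monoʳ-< r k<m∸r) (≤-reflexive (m+[n∸m]≡n (<⇒≤ r<m)))
    ... | no k≮m∸r with d , refl ← m≤n⇒∃[o]m+o≡n (≮⇒≥ k≮m∸r) = begin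
      t m (q * m + r + (m ∸ r + d))
        ≡⟨ cong (t m) (trans (regroup (q * m) r (m ∸ r) d) (cong (λ z → z + q * m + d) r+[m∸r]≡m)) ⟩
      t m (suc q * m + d)                     ≡⟨ t-digit (suc q) d<m ⟩
      (τ (suc q) + d) mod m                   ≡⟨ mod-cong wrap-around ⟨
      (τ q + r + (m ∸ r + d) + s) mod m       ≡⟨ window-≥ (τ q + r) s (m≤m+n (m ∸ r) d) ⟨
      window (τ q + r) (m ∸ r) s (m ∸ r + d)  ∎
      where
      open ≡-Reasoning
      s = τ (suc q) + (m ∸ τ q)
      r+[m∸r]≡m : r + (m ∸ r) ≡ m
      r+[m∸r]≡m = m+[n∸m]≡n (<⇒≤ r<m)
      τq+[m∸τq]≡m : τ q + (m ∸ τ q) ≡ m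
      τq+[m∸τq]≡m = m+[n∸m]≡n (<⇒≤ (toℕ<n (t m q)))
      d<m : d < m
      d<m = ≤-<-trans (m≤n+m d (m ∸ r)) k<m
      regroup : ∀ Q r r' d → Q + r + (r' + d) ≡ r + r' + Q + d
      regroup = solve-∀
      regroup₂ : ∀ a a' r r' d c → a + r + (r' + d) + (c + a') ≡ c + d + (a + a') + (r + r')
      regroup₂ = solve-∀
      wrap-around : (τ q + r + (m ∸ r + d) + s) % m ≡ (τ (suc q) + d) % m
      wrap-around = begin
        (τ q + r + (m ∸ r + d) + s) % m  ≡⟨ cong (_% m) (regroup₂ (τ q) (m ∸ τ q) r (m ∸ r) d (τ (suc q))) ⟩
        (τ (suc q) + d + (τ q + (m ∸ τ q)) + (r + (m ∸ r))) % m
          ≡⟨ cong₂ (λ u v → (τ (suc q) + d + u + v) % m) τq+[m∸τq]≡m r+[m∸r]≡m ⟩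
        (τ (suc q) + d + m + m) % m      ≡⟨ [m+n]%n≡m%n (τ (suc q) + d + m) m ⟩
        (τ (suc q) + d + m) % m          ≡⟨ [m+n]%n≡m%n (τ (suc q) + d) m ⟩
        (τ (suc q) + d) % m              ∎

    window-occurs : ∀ x {j} s → 0 < j → j ≤ m → ∃[ i ] ∀ k → k < m → t m (i + k) ≡ window x j s k
    window-occurs x {j} s 0<j j≤m with q , τq≡ , τ1+q≡ ← consecutive-letters (x + j) (x + j + s) =
      q * m + (m ∸ j) , λ k k<m → begin
        t m (q * m + (m ∸ j) + k)             ≡⟨ t-factor q (∸-monoʳ-< 0<j j≤m) k<m ⟩
        window x′ (m ∸ (m ∸ j)) s′ k          ≡⟨ cong (λ z → window x′ z s′ k) (m∸[m∸n]≡n j≤m) ⟩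
        window x′ j s′ k                      ≡⟨ window-cong-% x′ x j s′ s k x≡ s≡ ⟩
        window x j s k                        ∎
      where
      open ≡-Reasoning
      x′ = τ q + (m ∸ j)
      s′ = τ (suc q) + (m ∸ τ q)
      x≡ : (τ q + (m ∸ j)) % m ≡ x % m
      x≡ = begin
        (τ q + (m ∸ j)) % m          ≡⟨ cong (λ z → (z + (m ∸ j)) % m) τq≡ ⟩
        ((x + j) % m + (m ∸ j)) % m  ≡⟨ [m%n+o]%n≡[m+o]%n (x + j) (m ∸ j) ⟩
        (x + j + (m ∸ j)) % m        ≡⟨ cong (_% m) (trans (+-assoc x j (m ∸ j)) (cong (x +_) (m+[n∸m]≡n j≤m))) ⟩
        (x + m) % m                  ≡⟨ [m+n]%n≡m%n x m ⟩
        x % m                        ∎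
      s≡ : (τ (suc q) + (m ∸ τ q)) % m ≡ s % m
      s≡ = +-cancelˡ-% (τ q) (begin
        (τ q + (τ (suc q) + (m ∸ τ q))) % m
          ≡⟨ cong (_% m) (trans (x+[y+z]≡y+[x+z] (τ q) (τ (suc q)) (m ∸ τ q))
                                (cong (τ (suc q) +_) (m+[n∸m]≡n (<⇒≤ (toℕ<n (t m q)))))) ⟩
        (τ (suc q) + m) % m      ≡⟨ [m+n]%n≡m%n (τ (suc q)) m ⟩
        τ (suc q) % m            ≡⟨ cong (_% m) τ1+q≡ ⟩
        (x + j + s) % m % m      ≡⟨ m%n%n≡m%n (x + j + s) m ⟩
        (x + j + s) % m          ≡⟨ [m%n+o]%n≡[m+o]%n (x + j) s ⟨
        ((x + j) % m + s) % m    ≡⟨ cong (λ z → (z + s) % m) τq≡ ⟨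
        (τ q + s) % m            ∎)
        where
        x+[y+z]≡y+[x+z] : ∀ x y z → x + (y + z) ≡ y + (x + z)
        x+[y+z]≡y+[x+z] = solve-∀

module RauzyGraph (m' ℓ' : ℕ) (ℓ'<m' : ℓ' < m') where

  m ℓ : ℕ
  m = suc m'
  ℓ = suc ℓ'

  ℓ<m : ℓ < m
  ℓ<m = s<s ℓ'<m'

  1<m : 1 < m
  1<m = s<s (≤-<-trans z≤n ℓ'<m')

  open Windows m
  open Letters m

  -- A window is seen only through its first ℓ + 1 letters: either the jump is at the last position ℓ,
  -- by any s (s = 0 giving the jump-free window), or it is at a + 1 < ℓ, by b + 1 ≠ 0.
  Param : Set
  Param = Fin m × (Fin m ⊎ Fin ℓ' × Fin m')

  Fin↔Param : Fin (m * (m + ℓ' * m')) ↔ Param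
  Fin↔Param = ↔-trans *↔× (↔-refl ×-↔ ↔-trans +↔⊎ (↔-refl ⊎-↔ *↔×))

  jumpAt : Param → ℕ
  jumpAt (_ , inj₁ _)       = ℓ
  jumpAt (_ , inj₂ (a , _)) = suc (toℕ a)

  jumpBy : Param → ℕ
  jumpBy (_ , inj₁ s)       = toℕ s
  jumpBy (_ , inj₂ (_ , b)) = suc (toℕ b)

  word : Param → ℕ → Fin m
  word p = window (toℕ (proj₁ p)) (jumpAt p) (jumpBy p)

  0<jumpAt : ∀ p → 0 < jumpAt p
  0<jumpAt (_ , inj₁ _) = z<s
  0<jumpAt (_ , inj₂ _) = z<s

  jumpAt≤ℓ : ∀ p → jumpAt p ≤ ℓ
  jumpAt≤ℓ (_ , inj₁ _)       = ≤-refl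
  jumpAt≤ℓ (_ , inj₂ (a , _)) = <⇒≤ (s<s (toℕ<n a))

  jumpBy<m : ∀ p → jumpBy p < m
  jumpBy<m (_ , inj₁ s)       = toℕ<n s
  jumpBy<m (_ , inj₂ (_ , b)) = s<s (toℕ<n b)

  Param-ext : ∀ {p p'} → proj₁ p ≡ proj₁ p' → jumpAt p ≡ jumpAt p' → jumpBy p ≡ jumpBy p' → p ≡ p'
  Param-ext {x , inj₁ _}       {_ , inj₁ _}         refl _  s≡s' = cong (λ s → x , inj₁ s) (toℕ-injective s≡s')
  Param-ext {_ , inj₁ _}       {_ , inj₂ (a' , _)}  _    j≡j' _    = contradiction (sym j≡j') (<⇒≢ (s<s (toℕ<n a')))
  Param-ext {_ , inj₂ (a , _)} {_ , inj₁ _}         _    j≡j' _    = contradiction j≡j' (<⇒≢ (s<s (toℕ<n a)))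
  Param-ext {x , inj₂ _}       {_ , inj₂ _}         refl j≡j' s≡s' =
    cong₂ (λ a b → x , inj₂ (a , b)) (toℕ-injective (suc-injective j≡j')) (toℕ-injective (suc-injective s≡s'))

  jumpAt-determined : ∀ {p p'} → jumpBy p ≡ jumpBy p' → (0 < jumpBy p → jumpAt p ≡ jumpAt p') →
                      jumpAt p ≡ jumpAt p'
  jumpAt-determined {_ , inj₁ _} {_ , inj₁ _} _    _    = refl
  jumpAt-determined {_ , inj₁ _} {_ , inj₂ _} s≡s' 0<s⇒ = 0<s⇒ (subst (0 <_) (sym s≡s') z<s)
  jumpAt-determined {_ , inj₂ _} {_}          _    0<s⇒ = 0<s⇒ z<s

  Fin-window-is-word : ∀ (x : Fin m) {j} (s : Fin m) → 0 < j →
                       ∃[ p ] ∀ k → k ≤ ℓ → window (toℕ x) j (toℕ s) k ≡ word p k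
  Fin-window-is-word x {suc j₀} s _ with <-cmp (suc j₀) ℓ
  Fin-window-is-word x {suc j₀} zero    _ | tri< _ _ _ = (x , inj₁ zero) , λ k _ →
    trans (window-0 (toℕ x) (suc j₀) k) (sym (window-0 (toℕ x) ℓ k))
  Fin-window-is-word x {suc j₀} (suc b) _ | tri< j<ℓ _ _ = (x , inj₂ (fromℕ< (s<s⁻¹ j<ℓ) , b)) , λ k _ →
    cong (λ a → window (toℕ x) (suc a) (suc (toℕ b)) k) (sym (toℕ-fromℕ< (s<s⁻¹ j<ℓ)))
  ... | tri≈ _ refl _ = (x , inj₁ s) , λ _ _ → refl
  ... | tri> _ _ ℓ<j = (x , inj₁ zero) , λ k k≤ℓ →
    trans (window-< (toℕ x) (toℕ s) (≤-<-trans k≤ℓ ℓ<j)) (sym (window-0 (toℕ x) ℓ k))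

  window-is-word : ∀ x {j} s → 0 < j → ∃[ p ] ∀ k → k ≤ ℓ → window x j s k ≡ word p k
  window-is-word x {j} s 0<j =
    map₂ (λ agree k k≤ℓ → trans (reduce k) (agree k k≤ℓ)) (Fin-window-is-word (x mod m) (s mod m) 0<j)
    where
    reduce : ∀ k → window x j s k ≡ window (toℕ (x mod m)) j (toℕ (s mod m)) k
    reduce k =
      window-cong-% x (toℕ (x mod m)) j s (toℕ (s mod m)) k (sym (%-toℕ-mod x)) (sym (%-toℕ-mod s))

  factor-is-word : ∀ i → ∃[ p ] ∀ k → k ≤ ℓ → t m (i + k) ≡ word p k
  factor-is-word i =
    map₂ (λ agree k k≤ℓ → trans (factor k (≤-<-trans k≤ℓ ℓ<m)) (agree k k≤ℓ))
         (window-is-word (τ q + r) (τ (suc q) + (m ∸ τ q)) (m<n⇒0<n∸m r<m))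
    where
    q = i / m
    r = i % m
    r<m = m%n<n i m
    factor : ∀ k → k < m → t m (i + k) ≡ window (τ q + r) (m ∸ r) (τ (suc q) + (m ∸ τ q)) k
    factor k k<m = trans (cong (λ z → t m (z + k)) (i≡[i/m]*m+i%m i)) (t-factor 1<m q r<m k<m)

  word-occurs : ∀ p → ∃[ i ] ∀ k → k ≤ ℓ → t m (i + k) ≡ word p k
  word-occurs p =
    map₂ (λ occurs k k≤ℓ → occurs k (≤-<-trans k≤ℓ ℓ<m))
         (window-occurs 1<m (toℕ (proj₁ p)) (jumpBy p) (0<jumpAt p) (≤-trans (jumpAt≤ℓ p) (<⇒≤ ℓ<m)))

  edgeOf : (ℕ → Fin m) → Edge m
  edgeOf u = Ψ m (applyUpTo u ℓ) , Ψ m (applyUpTo (u ∘ suc) ℓ) , u 0 , u ℓ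

  edgeOf-cong : ∀ {u v} → (∀ k → k ≤ ℓ → u k ≡ v k) → edgeOf u ≡ edgeOf v
  edgeOf-cong u≗v =
    cong₂ _,_ (cong (Ψ m) (applyUpTo-cong ℓ (λ k k<ℓ → u≗v k (<⇒≤ k<ℓ))))
   (cong₂ _,_ (cong (Ψ m) (applyUpTo-cong ℓ (λ k k<ℓ → u≗v (suc k) k<ℓ)))
   (cong₂ _,_ (u≗v 0 z≤n) (u≗v ℓ ≤-refl)))

  factor-edge : ∀ i → edgeOf (λ k → t m (i + k)) ≡
                (Ψ m (factorAt m i ℓ) , Ψ m (factorAt m (suc i) ℓ) , t m i , t m (i + ℓ))
  factor-edge i =
    cong₂ _,_ (cong (Ψ m) (sym (map-upTo (λ k → t m (i + k)) ℓ)))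
   (cong₂ _,_ (cong (Ψ m) (sym (trans (map-upTo (λ k → t m (suc i + k)) ℓ)
                                      (applyUpTo-cong ℓ (λ k _ → cong (t m) (sym (+-suc i k)))))))
   (cong₂ _,_ (cong (t m) (+-identityʳ i)) refl))

  factor-IsEdge : ∀ i → IsEdge m ℓ (edgeOf (λ k → t m (i + k)))
  factor-IsEdge i = subst (IsEdge m ℓ) (sym (factor-edge i)) (i , refl , refl , refl , refl)

  IsEdge⇒factor : ∀ e → IsEdge m ℓ e → ∃[ i ] e ≡ edgeOf (λ k → t m (i + k))
  IsEdge⇒factor _ (i , refl , refl , refl , refl) = i , sym (factor-edge i)

  word-IsEdge : ∀ p → IsEdge m ℓ (edgeOf (word p))
  word-IsEdge p =
    let i , occurs = word-occurs p
    in subst (IsEdge m ℓ) (edgeOf-cong occurs) (factor-IsEdge i)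

  IsEdge⇒word : ∀ e → IsEdge m ℓ e → ∃[ p ] e ≡ edgeOf (word p)
  IsEdge⇒word e isEdge =
    let i , e≡ = IsEdge⇒factor e isEdge
        p , agree = factor-is-word i
    in p , trans e≡ (edgeOf-cong agree)

  word-first : ∀ p → word p 0 ≡ proj₁ p
  word-first (x , y) = begin
    word (x , y) 0               ≡⟨ window-< (toℕ x) (jumpBy (x , y)) (0<jumpAt (x , y)) ⟩
    (toℕ x + 0 + 0) mod m
      ≡⟨ cong (λ z → z mod m) (trans (+-identityʳ (toℕ x + 0)) (+-identityʳ (toℕ x))) ⟩
    toℕ x mod m                  ≡⟨ mod-toℕ x ⟩
    x                            ∎
    where open ≡-Reasoning

  word-last : ∀ p → word p ℓ ≡ (toℕ (proj₁ p) + ℓ + jumpBy p) mod m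
  word-last p = window-≥ (toℕ (proj₁ p)) (jumpBy p) (jumpAt≤ℓ p)

  edgeOf-word-injective : Injective _≡_ _≡_ (edgeOf ∘ word)
  edgeOf-word-injective {p} {p'} eq = Param-ext x≡x' j≡j' s≡s'
    where
    open ≡-Reasoning
    x = toℕ (proj₁ p)
    x≡x' : proj₁ p ≡ proj₁ p'
    x≡x' = trans (sym (word-first p)) (trans (cong (proj₁ ∘ proj₂ ∘ proj₂) eq) (word-first p'))
    s≡s' : jumpBy p ≡ jumpBy p'
    s≡s' = +-mod-injective (x + ℓ) (jumpBy<m p) (jumpBy<m p') (begin
      (x + ℓ + jumpBy p) mod m                ≡⟨ word-last p ⟨
      word p ℓ                                ≡⟨ cong (proj₂ ∘ proj₂ ∘ proj₂) eq ⟩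
      word p' ℓ                               ≡⟨ word-last p' ⟩
      (toℕ (proj₁ p') + ℓ + jumpBy p') mod m  ≡⟨ cong (λ y → (toℕ y + ℓ + jumpBy p') mod m) x≡x' ⟨
      (x + ℓ + jumpBy p') mod m               ∎)
    j≡j' : jumpAt p ≡ jumpAt p'
    j≡j' = jumpAt-determined s≡s' λ 0<s →
      window-Ψ-injective x (jumpBy p) (jumpAt≤ℓ p) (jumpAt≤ℓ p') ℓ<m 0<s (jumpBy<m p) (begin
        Ψ m (applyUpTo (word p) ℓ)                           ≡⟨ cong proj₁ eq ⟩
        Ψ m (applyUpTo (word p') ℓ)
          ≡⟨ cong₂ (λ y s → Ψ m (applyUpTo (window (toℕ y) (jumpAt p') s) ℓ)) x≡x' s≡s' ⟨
        Ψ m (applyUpTo (window x (jumpAt p') (jumpBy p)) ℓ)  ∎)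

  edges : Σ (List (Edge m)) λ E → Unique E × All (IsEdge m ℓ) E ×
          ((e : Edge m) → IsEdge m ℓ e → e ∈ E) × length E ≡ m * (m + ℓ' * m')
  edges = enumerate-image (IsEdge m ℓ) Fin↔Param (edgeOf ∘ word) edgeOf-word-injective word-IsEdge IsEdge⇒word

edge-count : ∀ m' ℓ' → suc m' * (suc m' + ℓ' * m') ≡ suc m' * ((1 + suc ℓ' * suc m') ∸ suc ℓ')
edge-count m' ℓ' = cong (suc m' *_) (sym (trans (cong (_∸ suc ℓ') (identity m' ℓ')) (m+n∸n≡m _ (suc ℓ'))))
  where
  identity : ∀ m' ℓ' → 1 + suc ℓ' * suc m' ≡ suc m' + ℓ' * m' + suc ℓ'
  identity = solve-∀

proposition9p3 : (m ℓ : ℕ) .{{_ : NonZero m}} → 2 ≤ m → 1 ≤ ℓ → ℓ < m →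
    Σ (List (Edge m)) (λ E → Unique E × All (IsEdge m ℓ) E
      × ((e : Edge m) → IsEdge m ℓ e → e ∈ E)
      × length E ≡ m * ((1 + ℓ * m) ∸ ℓ))
-- 2 ≤ m follows from 1 ≤ ℓ < m.
proposition9p3 (suc m') (suc ℓ') _ (s≤s z≤n) (s≤s ℓ'<m') =
  let E , unique , sound , complete , |E| = RauzyGraph.edges m' ℓ' ℓ'<m'
  in E , unique , sound , complete , trans |E| (edge-count m' ℓ')
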